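{- Let $\mathcal{M}=(Q,r)$ be a sparse paving matroid of rank $k$ and let $X,Y\subseteq Q$ be a disjoint nonmodular pair of flats. If $r(X)+r(Y)=k+1$ and $X$ is not a circuit-hyperplane, then there is a quasi-intersection of $(X,Y)$ in $\mathcal{M}$.
   Context: Write $AB=A\cup B$ and $r(A|B)=r(AB)-r(B)$. A flat is a set $F$ with $r(Fx)>r(F)$ for all $x\notin F$; flats $X,Y$ are modular if $r(X)+r(Y)=r(XY)+r(X\cap Y)$, nonmodular otherwise. A matroid of rank $k$ is paving if every circuit has rank $k$ or $k-1$, and sparse paving if moreover every circuit of rank $k-1$ is a flat (a circuit-hyperplane). A quasi-intersection of a nonmodular pair of flats $(X,Y)$ is a flat $T\subseteq Q$ with (DL1) $r(T|X)=0$ and (DL2) for every flat $X'\subseteq X$: $r(T|X')=0$ if and only if $r(Y|X')=r(Y|X)$. -}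

module Defs where

open import Data.Nat using (ℕ; _+_; _∸_; _≤_; _<_)
open import Data.Fin using (Fin)
open import Data.Fin.Subset using (Subset; _∪_; _∩_; _⊆_; ∣_∣; ⁅_⁆; _∉_; ⊤; ⊥)
open import Data.Product using (_×_; Σ)
open import Data.Sum using (_⊎_)
open import Relation.Binary.PropositionalEquality using (_≡_; _≢_)
open import Relation.Nullary using (¬_)
open import Function.Bundles using (_⇔_)

-- A matroid on the finite ground set Q = Fin n, given by its rank function
-- (standard rank axioms R1-R3).
record Matroid (n : ℕ) : Set where
  field
    r          : Subset n → ℕ
    bounded    : ∀ A → r A ≤ ∣ A ∣
    monotone   : ∀ {A B} → A ⊆ B → r A ≤ r B
    submodular : ∀ A B → r (A ∪ B) + r (A ∩ B) ≤ r A + r B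

module _ {n : ℕ} (M : Matroid n) where
  open Matroid M

  condRank : Subset n → Subset n → ℕ
  condRank A B = r (A ∪ B) ∸ r B

  rankOf : Subset n → ℕ
  rankOf = r

  HasRank : ℕ → Set
  HasRank k = r ⊤ ≡ k

  Flat : Subset n → Set
  Flat F = ∀ x → x ∉ F → r F < r (F ∪ ⁅ x ⁆)

  Modular : Subset n → Subset n → Set
  Modular X Y = r X + r Y ≡ r (X ∪ Y) + r (X ∩ Y)

  Nonmodular : Subset n → Subset n → Set
  Nonmodular X Y = ¬ Modular X Y

  Dependent : Subset n → Set
  Dependent A = r A < ∣ A ∣

  Circuit : Subset n → Set
  Circuit C = Dependent C × (∀ D → D ⊆ C → D ≢ C → ¬ Dependent D)

  Paving : ℕ → Set
  Paving k = ∀ C → Circuit C → (r C ≡ k) ⊎ (r C ≡ k ∸ 1)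

  SparsePaving : ℕ → Set
  SparsePaving k = Paving k × (∀ C → Circuit C → r C ≡ k ∸ 1 → Flat C)

  CircuitHyperplane : ℕ → Subset n → Set
  CircuitHyperplane k C = Circuit C × Flat C × r C ≡ k ∸ 1

  Disjoint : Subset n → Subset n → Set
  Disjoint X Y = X ∩ Y ≡ ⊥

  QuasiIntersection : Subset n → Subset n → Subset n → Set
  QuasiIntersection X Y T =
    Flat T ×
    condRank T X ≡ 0 ×
    (∀ X' → Flat X' → X' ⊆ X → (condRank T X' ≡ 0 ⇔ condRank Y X' ≡ condRank Y X))

{-# OPTIONS --safe #-}
module Submission where

-- In a sparse paving matroid of rank k, a flat X of rank below k that is not a
-- circuit-hyperplane is independent: a circuit C ⊆ X has rank < k, hence rank
-- k - 1, hence is a flat, and a flat inside X of rank ≥ r(X) is X itself.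
-- Here r(X) < k because r(Y) > 0 gives an element of Y, which lies outside X.
--
-- On subsets of an independent set the rank is modular, so submodularity of
-- A ↦ r(Y ∪ A) makes the flats X' ⊆ X with r(Y|X') = r(Y|X) closed under
-- intersection. Their least member T is a quasi-intersection, because for a
-- flat X' we have r(T|X') = 0 exactly when T ⊆ X'.

open import Defs
open import Data.Nat using (ℕ; suc; _+_; _≤_; _<_)
open import Data.Nat.Properties
open import Data.Nat.Induction using (<-wellFounded)
open import Data.Fin.Subset
  using (Subset; _∪_; _∩_; _⊆_; ∁; ∣_∣; ⁅_⁆; _∈_; _∉_; ⊤; Nonempty; inside; outside)
  renaming (⊥ to ∅)
open import Data.Fin.Subset.Properties
open import Data.Fin.Properties using (any?; all?)
open import Data.Vec using ([]; _∷_)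
open import Data.Product using (Σ; _×_; _,_)
open import Data.Sum using (inj₁; inj₂; [_,_])
open import Induction.WellFounded using (Acc; acc)
open import Relation.Binary.PropositionalEquality hiding ([_])
open import Relation.Nullary using (¬_; yes; no; ¬?; contradiction)
open import Relation.Nullary.Decidable using (_→-dec_; _×-dec_; decidable-stable)
open import Relation.Unary using (Pred; Decidable)
open import Function.Bundles using (mk⇔)
open import Level using (0ℓ)
open import Algebra.Properties.CommutativeSemigroup +-commutativeSemigroup
  using (interchange; xy∙z≈xz∙y)
import Algebra.Properties.CommutativeSemigroup as CommutativeSemigroupProperties
open import Algebra.Bundles using (CommutativeMonoid)

∪-interchange : ∀ {n} (p q r s : Subset n) → (p ∪ q) ∪ (r ∪ s) ≡ (p ∪ r) ∪ (q ∪ s)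
∪-interchange {n} = CommutativeSemigroupProperties.interchange
  (CommutativeMonoid.commutativeSemigroup (∪-commutativeMonoid n))

∪-least : ∀ {n} {p q s : Subset n} → p ⊆ s → q ⊆ s → p ∪ q ⊆ s
∪-least {p = p} {q} p⊆s q⊆s x∈p∪q = [ p⊆s , q⊆s ] (x∈p∪q⁻ p q x∈p∪q)

∩-greatest : ∀ {n} {p q s : Subset n} → s ⊆ p → s ⊆ q → s ⊆ p ∩ q
∩-greatest s⊆p s⊆q x∈s = x∈p∩q⁺ (s⊆p x∈s , s⊆q x∈s)

∣p∪q∣+∣p∩q∣≡∣p∣+∣q∣ : ∀ {n} (p q : Subset n) → ∣ p ∪ q ∣ + ∣ p ∩ q ∣ ≡ ∣ p ∣ + ∣ q ∣
∣p∪q∣+∣p∩q∣≡∣p∣+∣q∣ []            []            = refl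
∣p∪q∣+∣p∩q∣≡∣p∣+∣q∣ (inside  ∷ p) (inside  ∷ q) = cong suc (begin
  ∣ p ∪ q ∣ + suc ∣ p ∩ q ∣  ≡⟨ +-suc ∣ p ∪ q ∣ ∣ p ∩ q ∣ ⟩
  suc (∣ p ∪ q ∣ + ∣ p ∩ q ∣) ≡⟨ cong suc (∣p∪q∣+∣p∩q∣≡∣p∣+∣q∣ p q) ⟩
  suc (∣ p ∣ + ∣ q ∣)         ≡⟨ +-suc ∣ p ∣ ∣ q ∣ ⟨
  ∣ p ∣ + suc ∣ q ∣           ∎)
  where open ≡-Reasoning
∣p∪q∣+∣p∩q∣≡∣p∣+∣q∣ (inside  ∷ p) (outside ∷ q) = cong suc (∣p∪q∣+∣p∩q∣≡∣p∣+∣q∣ p q)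
∣p∪q∣+∣p∩q∣≡∣p∣+∣q∣ (outside ∷ p) (inside  ∷ q) =
  trans (cong suc (∣p∪q∣+∣p∩q∣≡∣p∣+∣q∣ p q)) (sym (+-suc ∣ p ∣ ∣ q ∣))
∣p∪q∣+∣p∩q∣≡∣p∣+∣q∣ (outside ∷ p) (outside ∷ q) = ∣p∪q∣+∣p∩q∣≡∣p∣+∣q∣ p q

p⊆q∧p≢q⇒∣p∣<∣q∣ : ∀ {n} {p q : Subset n} → p ⊆ q → p ≢ q → ∣ p ∣ < ∣ q ∣
p⊆q∧p≢q⇒∣p∣<∣q∣ {p = p} {q} p⊆q p≢q with any? (λ x → x ∈? q ×-dec ¬? (x ∈? p))
... | yes (x , x∈q , x∉p) = p⊂q⇒∣p∣<∣q∣ (p⊆q , x , x∈q , x∉p)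
... | no noWitness = contradiction (⊆-antisym p⊆q q⊆p) p≢q
  where
  q⊆p : q ⊆ p
  q⊆p {x} x∈q = decidable-stable (x ∈? p) (λ x∉p → noWitness (x , x∈q , x∉p))

argmin : ∀ {n} {P : Pred (Subset n) 0ℓ} → Decidable P → (μ : Subset n → ℕ) →
         ∀ {A} → P A → Σ (Subset n) λ T → P T × (∀ {B} → P B → μ T ≤ μ B)
argmin {n} {P} P? μ {A} pA = go pA (<-wellFounded (μ A))
  where
  go : ∀ {A} → P A → Acc _<_ (μ A) → Σ (Subset n) λ T → P T × (∀ {B} → P B → μ T ≤ μ B)
  go {A} pA (acc smaller) with anySubset? (λ B → P? B ×-dec μ B <? μ A)
  ... | yes (B , pB , μB<μA) = go pB (smaller μB<μA)
  ... | no noSmaller = A , pA , λ pB → ≮⇒≥ (λ μB<μA → noSmaller (_ , pB , μB<μA))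

module _ {n : ℕ} (M : Matroid n) where
  open Matroid M

  rank>0⇒nonempty : ∀ {A} → 0 < r A → Nonempty A
  rank>0⇒nonempty {A} 0<rA with nonempty? A
  ... | yes nonempty = nonempty
  ... | no empty = contradiction (begin-strict
    0          <⟨ 0<rA ⟩
    r A        ≡⟨ cong r (Empty-unique empty) ⟩
    r ∅        ≤⟨ bounded ∅ ⟩
    ∣ ∅ {n} ∣  ≡⟨ ∣⊥∣≡0 n ⟩
    0          ∎) (<-irrefl refl)
    where open ≤-Reasoning

  flat? : Decidable (Flat M)
  flat? F = all? (λ x → ¬? (x ∈? F) →-dec (r F <? r (F ∪ ⁅ x ⁆)))

  flat-maximal : ∀ {F G} → Flat M F → F ⊆ G → r G ≤ r F → G ⊆ F
  flat-maximal {F} {G} flF F⊆G rG≤rF {x} x∈G with x ∈? F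
  ... | yes x∈F = x∈F
  ... | no x∉F = contradiction (begin-strict
    r F               <⟨ flF x x∉F ⟩
    r (F ∪ ⁅ x ⁆)     ≤⟨ monotone (∪-least F⊆G ⁅x⁆⊆G) ⟩
    r G               ≤⟨ rG≤rF ⟩
    r F               ∎) (<-irrefl refl)
    where
    open ≤-Reasoning
    ⁅x⁆⊆G : ⁅ x ⁆ ⊆ G
    ⁅x⁆⊆G y∈⁅x⁆ = subst (_∈ G) (sym (x∈⁅y⁆⇒x≡y x y∈⁅x⁆)) x∈G

  flat-∉⇒rank< : ∀ {F x} → Flat M F → x ∉ F → r F < r ⊤
  flat-∉⇒rank< flF x∉F = <-≤-trans (flF _ x∉F) (monotone ⊆⊤)

  -- Submodularity against F: an element outside F raises the rank of F, hence of any S ⊆ F.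
  ⊆-flat-∉⇒rank< : ∀ {F S x} → Flat M F → S ⊆ F → x ∉ F → r S < r (S ∪ ⁅ x ⁆)
  ⊆-flat-∉⇒rank< {F} {S} {x} flF S⊆F x∉F = +-cancelˡ-< (r F) (r S) (r (S ∪ ⁅ x ⁆)) (begin-strict
    r F + r S                              <⟨ +-monoˡ-< (r S) (flF x x∉F) ⟩
    r (F ∪ ⁅ x ⁆) + r S                    ≤⟨ +-mono-≤ (monotone (∪-least (p⊆p∪q _) (⊆-trans (q⊆p∪q S ⁅ x ⁆) (q⊆p∪q F _))))
                                                       (monotone (∩-greatest S⊆F (p⊆p∪q ⁅ x ⁆))) ⟩
    r (F ∪ (S ∪ ⁅ x ⁆)) + r (F ∩ (S ∪ ⁅ x ⁆)) ≤⟨ submodular F (S ∪ ⁅ x ⁆) ⟩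
    r F + r (S ∪ ⁅ x ⁆)                    ∎)
    where open ≤-Reasoning

  flat-∩ : ∀ {F G} → Flat M F → Flat M G → Flat M (F ∩ G)
  flat-∩ {F} {G} flF flG x x∉F∩G with x ∈? F
  ... | no x∉F = ⊆-flat-∉⇒rank< flF (p∩q⊆p F G) x∉F
  ... | yes x∈F = ⊆-flat-∉⇒rank< flG (p∩q⊆q F G) (λ x∈G → x∉F∩G (x∈p∩q⁺ (x∈F , x∈G)))

  ⊆⇒condRank≡0 : ∀ {A B} → A ⊆ B → condRank M A B ≡ 0
  ⊆⇒condRank≡0 A⊆B = m≤n⇒m∸n≡0 (monotone (∪-least A⊆B ⊆-refl))

  condRank≡0⇒⊆ : ∀ {A F} → Flat M F → condRank M A F ≡ 0 → A ⊆ F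
  condRank≡0⇒⊆ {A} {F} flF r[A|F]≡0 =
    ⊆-trans (p⊆p∪q F) (flat-maximal flF (q⊆p∪q A F) (m∸n≡0⇒m≤n r[A|F]≡0))

  Independent : Subset n → Set
  Independent A = ∣ A ∣ ≤ r A

  independent-⊆ : ∀ {A S} → Independent A → S ⊆ A → Independent S
  independent-⊆ {A} {S} indA S⊆A = +-cancelʳ-≤ ∣ D ∣ ∣ S ∣ (r S) (begin
    ∣ S ∣ + ∣ D ∣           ≡⟨ ∣p∪q∣+∣p∩q∣≡∣p∣+∣q∣ S D ⟨
    ∣ S ∪ D ∣ + ∣ S ∩ D ∣   ≤⟨ +-mono-≤ (p⊆q⇒∣p∣≤∣q∣ (∪-least S⊆A (p∩q⊆p A (∁ S)))) ∣S∩D∣≤0 ⟩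
    ∣ A ∣ + 0               ≡⟨ +-identityʳ ∣ A ∣ ⟩
    ∣ A ∣                   ≤⟨ indA ⟩
    r A                     ≤⟨ monotone A⊆S∪D ⟩
    r (S ∪ D)               ≤⟨ m≤m+n (r (S ∪ D)) (r (S ∩ D)) ⟩
    r (S ∪ D) + r (S ∩ D)   ≤⟨ submodular S D ⟩
    r S + r D               ≤⟨ +-monoʳ-≤ (r S) (bounded D) ⟩
    r S + ∣ D ∣             ∎)
    where
    open ≤-Reasoning
    D : Subset n
    D = A ∩ ∁ S
    A⊆S∪D : A ⊆ S ∪ D
    A⊆S∪D {x} x∈A with x ∈? S
    ... | yes x∈S = x∈p∪q⁺ (inj₁ x∈S)
    ... | no x∉S = x∈p∪q⁺ (inj₂ (x∈p∩q⁺ (x∈A , x∉p⇒x∈∁p x∉S)))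
    ∣S∩D∣≤0 : ∣ S ∩ D ∣ ≤ 0
    ∣S∩D∣≤0 = subst (∣ S ∩ D ∣ ≤_) (∣⊥∣≡0 n) (p⊆q⇒∣p∣≤∣q∣ S∩D⊆∅)
      where
      S∩D⊆∅ : S ∩ D ⊆ ∅
      S∩D⊆∅ x∈S∩D = let x∈S , x∈D = x∈p∩q⁻ S D x∈S∩D
                    in contradiction x∈S (x∈∁p⇒x∉p (p∩q⊆q A (∁ S) x∈D))

  independent⇒modular : ∀ {A B} → Independent (A ∪ B) → Modular M A B
  independent⇒modular {A} {B} indA∪B = ≤-antisym (begin
    r A + r B                 ≤⟨ +-mono-≤ (bounded A) (bounded B) ⟩
    ∣ A ∣ + ∣ B ∣             ≡⟨ ∣p∪q∣+∣p∩q∣≡∣p∣+∣q∣ A B ⟨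
    ∣ A ∪ B ∣ + ∣ A ∩ B ∣     ≤⟨ +-mono-≤ indA∪B (independent-⊆ indA∪B (⊆-trans (p∩q⊆p A B) (p⊆p∪q B))) ⟩
    r (A ∪ B) + r (A ∩ B)     ∎) (submodular A B)
    where open ≤-Reasoning

  dependent⇒circuit : ∀ {A} → Dependent M A → Σ (Subset n) λ C → C ⊆ A × Circuit M C
  dependent⇒circuit {A} depA with argmin (λ D → (D ⊆? A) ×-dec (r D <? ∣ D ∣)) ∣_∣ (⊆-refl , depA)
  ... | C , (C⊆A , depC) , smallest = C , C⊆A , depC , minimal
    where
    minimal : ∀ D → D ⊆ C → D ≢ C → ¬ Dependent M D
    minimal D D⊆C D≢C depD =
      <⇒≱ (p⊆q∧p≢q⇒∣p∣<∣q∣ D⊆C D≢C) (smallest (⊆-trans D⊆C C⊆A , depD))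

  -- The function A ↦ r(Y ∪ A) is the rank function of the contraction by Y, up to the constant r(Y).
  contraction-submodular : ∀ Y A B → r (Y ∪ (A ∪ B)) + r (Y ∪ (A ∩ B)) ≤ r (Y ∪ A) + r (Y ∪ B)
  contraction-submodular Y A B =
    subst₂ (λ U I → r U + r I ≤ r (Y ∪ A) + r (Y ∪ B)) union (sym (∪-distribˡ-∩ Y A B))
      (submodular (Y ∪ A) (Y ∪ B))
    where
    union : (Y ∪ A) ∪ (Y ∪ B) ≡ Y ∪ (A ∪ B)
    union = trans (∪-interchange Y A Y B) (cong (_∪ (A ∪ B)) (∪-idem Y))

  condRank+rank : ∀ Y A → condRank M Y A + r A ≡ r (Y ∪ A)
  condRank+rank Y A = m∸n+n≡m (monotone (q⊆p∪q Y A))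

  condRank-antitone : ∀ Y {A B} → A ⊆ B → condRank M Y B ≤ condRank M Y A
  condRank-antitone Y {A} {B} A⊆B = +-cancelʳ-≤ (r A) _ _ (+-cancelʳ-≤ (r B) _ _ (begin
    condRank M Y B + r A + r B        ≡⟨ xy∙z≈xz∙y (condRank M Y B) (r A) (r B) ⟩
    condRank M Y B + r B + r A        ≡⟨ cong (_+ r A) (condRank+rank Y B) ⟩
    r (Y ∪ B) + r A                   ≤⟨ +-mono-≤ (monotone (∪-least (⊆-trans (p⊆p∪q A) (p⊆p∪q B)) (q⊆p∪q _ B)))
                                                  (monotone (∩-greatest (q⊆p∪q Y A) A⊆B)) ⟩
    r ((Y ∪ A) ∪ B) + r ((Y ∪ A) ∩ B) ≤⟨ submodular (Y ∪ A) B ⟩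
    r (Y ∪ A) + r B                   ≡⟨ cong (_+ r B) (condRank+rank Y A) ⟨
    condRank M Y A + r A + r B        ∎))
    where open ≤-Reasoning

  condRank-submodular : ∀ Y {A B} → Modular M A B →
    condRank M Y (A ∪ B) + condRank M Y (A ∩ B) ≤ condRank M Y A + condRank M Y B
  condRank-submodular Y {A} {B} modAB = +-cancelʳ-≤ (r (A ∪ B) + r (A ∩ B)) _ _ (begin
    (f (A ∪ B) + f (A ∩ B)) + (r (A ∪ B) + r (A ∩ B)) ≡⟨ interchange (f (A ∪ B)) _ _ _ ⟩
    (f (A ∪ B) + r (A ∪ B)) + (f (A ∩ B) + r (A ∩ B)) ≡⟨ cong₂ _+_ (condRank+rank Y (A ∪ B)) (condRank+rank Y (A ∩ B)) ⟩
    r (Y ∪ (A ∪ B)) + r (Y ∪ (A ∩ B))                 ≤⟨ contraction-submodular Y A B ⟩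
    r (Y ∪ A) + r (Y ∪ B)                             ≡⟨ cong₂ _+_ (condRank+rank Y A) (condRank+rank Y B) ⟨
    (f A + r A) + (f B + r B)                         ≡⟨ interchange (f A) _ _ _ ⟩
    (f A + f B) + (r A + r B)                         ≡⟨ cong (f A + f B +_) modAB ⟩
    (f A + f B) + (r (A ∪ B) + r (A ∩ B))             ∎)
    where
    open ≤-Reasoning
    f : Subset n → ℕ
    f = condRank M Y

  module LeastAdmissible (Y : Subset n) {X : Subset n} (indX : Independent X) where

    -- The quasi-intersection is the intersection of all admissible flats.
    Admissible : Subset n → Set
    Admissible A = Flat M A × A ⊆ X × condRank M Y A ≡ condRank M Y X

    admissible? : Decidable Admissible
    admissible? A = flat? A ×-dec (A ⊆? X) ×-dec (condRank M Y A ≟ condRank M Y X)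

    admissible-∩ : ∀ {A B} → Admissible A → Admissible B → Admissible (A ∩ B)
    admissible-∩ {A} {B} (flA , A⊆X , fA≡fX) (flB , B⊆X , fB≡fX) =
      flat-∩ flA flB , A∩B⊆X , ≤-antisym f[A∩B]≤fX (condRank-antitone Y A∩B⊆X)
      where
      open ≤-Reasoning
      f : Subset n → ℕ
      f = condRank M Y
      A∪B⊆X : A ∪ B ⊆ X
      A∪B⊆X = ∪-least A⊆X B⊆X
      A∩B⊆X : A ∩ B ⊆ X
      A∩B⊆X = ⊆-trans (p∩q⊆p A B) A⊆X
      f[A∩B]≤fX : f (A ∩ B) ≤ f X
      f[A∩B]≤fX = +-cancelˡ-≤ (f X) (f (A ∩ B)) (f X) (begin
        f X + f (A ∩ B)          ≤⟨ +-monoˡ-≤ (f (A ∩ B)) (condRank-antitone Y A∪B⊆X) ⟩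
        f (A ∪ B) + f (A ∩ B)    ≤⟨ condRank-submodular Y (independent⇒modular (independent-⊆ indX A∪B⊆X)) ⟩
        f A + f B                ≡⟨ cong₂ _+_ fA≡fX fB≡fX ⟩
        f X + f X                ∎)

    leastAdmissible : Admissible X → Σ (Subset n) λ T → Admissible T × (∀ {B} → Admissible B → T ⊆ B)
    leastAdmissible admX with argmin admissible? r admX
    ... | T , admT@(flT , _ , _) , rankMinimal = T , admT , least
      where
      least : ∀ {B} → Admissible B → T ⊆ B
      least {B} admB@(flB , _ , _) = ⊆-trans
        (flat-maximal (flat-∩ flT flB) (p∩q⊆p T B) (rankMinimal (admissible-∩ admT admB)))
        (p∩q⊆q T B)

  independent⇒quasiIntersection : ∀ {X} → Flat M X → Independent X →
    ∀ Y → Σ (Subset n) (QuasiIntersection M X Y)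
  independent⇒quasiIntersection flX indX Y
    with LeastAdmissible.leastAdmissible Y indX (flX , ⊆-refl , refl)
  ... | T , (flT , T⊆X , fT≡fX) , least = T , flT , ⊆⇒condRank≡0 T⊆X , λ X' flX' X'⊆X →
    mk⇔ (λ r[T|X']≡0 → ≤-antisym
           (≤-trans (condRank-antitone Y (condRank≡0⇒⊆ flX' r[T|X']≡0)) (≤-reflexive fT≡fX))
           (condRank-antitone Y X'⊆X))
        (λ fX'≡fX → ⊆⇒condRank≡0 (least (flX' , X'⊆X , fX'≡fX)))

  sparsePaving-circuit⊆flat⇒circuitHyperplane : ∀ {k C X} → SparsePaving M k → Flat M X → r X < k →
    Circuit M C → C ⊆ X → CircuitHyperplane M k X
  sparsePaving-circuit⊆flat⇒circuitHyperplane {k} {C} {X} (paving , sparse) flX rX<k circC C⊆X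
    with paving C circC
  ... | inj₁ rC≡k = contradiction (≤-<-trans (monotone C⊆X) rX<k) (<-irrefl rC≡k)
  ... | inj₂ rC≡k∸1 = subst (CircuitHyperplane M k) C≡X (circC , flC , rC≡k∸1)
    where
    flC : Flat M C
    flC = sparse C circC rC≡k∸1
    C≡X : C ≡ X
    C≡X = ⊆-antisym C⊆X (flat-maximal flC C⊆X (subst (r X ≤_) (sym rC≡k∸1) (∸-monoˡ-≤ 1 rX<k)))

  sparsePaving-flat⇒independent : ∀ {k X} → SparsePaving M k → Flat M X → r X < k →
    ¬ CircuitHyperplane M k X → Independent X
  sparsePaving-flat⇒independent {X = X} sp flX rX<k notCH with ∣ X ∣ ≤? r X
  ... | yes indX = indX
  ... | no depX with dependent⇒circuit (≰⇒> depX)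
  ...   | C , C⊆X , circC =
    contradiction (sparsePaving-circuit⊆flat⇒circuitHyperplane sp flX rX<k circC C⊆X) notCH

-- Y need not be a flat and (X, Y) need not be nonmodular: once X is
-- independent, every Y has a quasi-intersection with X.
proposition5p11 : ∀ {n : ℕ} (M : Matroid n) (k : ℕ) → HasRank M k → SparsePaving M k →
    (X Y : Subset n) → Flat M X → Flat M Y → Disjoint M X Y → Nonmodular M X Y →
    Matroid.r M X + Matroid.r M Y ≡ k + 1 → ¬ CircuitHyperplane M k X →
    Σ (Subset n) (λ T → QuasiIntersection M X Y T)
proposition5p11 M k r⊤≡k sp X Y flX _ X∩Y≡∅ _ rX+rY≡k+1 notCH =
  independent⇒quasiIntersection M flX (sparsePaving-flat⇒independent M sp flX rX<k notCH) Y
  where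
  open Matroid M
  open ≤-Reasoning
  0<rY : 0 < r Y
  0<rY = +-cancelˡ-< (r X) 0 (r Y) (begin-strict
    r X + 0    ≡⟨ +-identityʳ (r X) ⟩
    r X        ≤⟨ subst (r X ≤_) r⊤≡k (monotone ⊆⊤) ⟩
    k          <⟨ subst (k <_) (+-comm 1 k) (n<1+n k) ⟩
    k + 1      ≡⟨ rX+rY≡k+1 ⟨
    r X + r Y  ∎)
  rX<k : r X < k
  rX<k with rank>0⇒nonempty M 0<rY
  ... | y , y∈Y = subst (r X <_) r⊤≡k
    (flat-∉⇒rank< M flX (λ y∈X → ∉⊥ (subst (y ∈_) X∩Y≡∅ (x∈p∩q⁺ (y∈X , y∈Y)))))
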